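{- For any $\sigma\in\mathfrak S_n$, with $\tau=\Phi(\sigma)$, $$\ell_T(\sigma)=[21](\tau)+A(\tau),$$ where $A(\tau)$ is the number of positions $j\in\{1,\dots,n-1\}$ with $\tau_j<\tau_{j+1}$ and $\sigma(\tau_j)=\tau_{j+1}$.
   Context: $\ell_T(\sigma)$ is the reflection length (minimal number of transpositions with product $\sigma$; equivalently $n$ minus the number of cycles). The fundamental bijection $\Phi$: write $\sigma$ in cycle notation with each cycle beginning with its largest element and cycles ordered by increasing largest element; erasing parentheses gives the one-line notation of $\Phi(\sigma)$. $[21](\tau)$ is the number of positions $j$ with $\tau_j>\tau_{j+1}$. -}

module Defs where

open import Data.Nat using (ℕ; zero; suc; _∸_; _<ᵇ_)
open import Data.Fin using (Fin; _≤?_; _<?_; _≟_)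
open import Data.Fin.Permutation using (Permutation′; _⟨$⟩ʳ_)
open import Data.List using (List; []; _∷_; map; filter; takeWhile; concatMap; length; allFin; upTo)
open import Data.List.Relation.Unary.All using (All)
open import Relation.Nullary using (¬_; Dec; yes; no)
open import Relation.Nullary.Decidable using (¬?)
open import Data.List.Relation.Unary.All using (all?)
open import Data.Product using (_×_; _,_)
open import Relation.Nullary.Decidable using (_×-dec_)
open import Relation.Binary.PropositionalEquality using (_≡_)

-- Permutations of [n] are modelled as permutations of Fin n = {0,…,n-1}
-- (values shifted by one; all order relations are preserved).

iter : ∀ {n} → Permutation′ n → ℕ → Fin n → Fin n
iter σ zero    i = i
iter σ (suc k) i = σ ⟨$⟩ʳ (iter σ k i)

orbit : ∀ {n} → Permutation′ n → Fin n → List (Fin n)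
orbit {n} σ i = map (λ k → iter σ k i) (upTo n)

IsCycleMax : ∀ {n} → Permutation′ n → Fin n → Set
IsCycleMax σ i = All (λ j → j Data.Fin.≤ i) (orbit σ i)

isCycleMax? : ∀ {n} (σ : Permutation′ n) (i : Fin n) → Dec (IsCycleMax σ i)
isCycleMax? σ i = all? (λ j → j ≤? i) (orbit σ i)

cycleMaxima : ∀ {n} → Permutation′ n → List (Fin n)
cycleMaxima {n} σ = filter (isCycleMax? σ) (allFin n)

numCycles : ∀ {n} → Permutation′ n → ℕ
numCycles σ = length (cycleMaxima σ)

ℓT : ∀ {n} → Permutation′ n → ℕ
ℓT {n} σ = n ∸ numCycles σ

cycleFrom : ∀ {n} → Permutation′ n → Fin n → List (Fin n)
cycleFrom {n} σ m = m ∷ takeWhile (λ j → ¬? (j ≟ m)) (map (λ k → iter σ (suc k) m) (upTo n))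

-- the fundamental bijection Φ: cycles beginning with their largest element, ordered by
-- increasing largest element; erase parentheses.  Result = one-line notation of Φ(σ).
Φ : ∀ {n} → Permutation′ n → List (Fin n)
Φ σ = concatMap (cycleFrom σ) (cycleMaxima σ)

adjPairs : ∀ {A : Set} → List A → List (A × A)
adjPairs []           = []
adjPairs (x ∷ [])     = []
adjPairs (x ∷ y ∷ xs) = (x , y) ∷ adjPairs (y ∷ xs)

des : ∀ {n} → List (Fin n) → ℕ
des τ = length (filter (λ p → Data.Product.proj₂ p <? Data.Product.proj₁ p) (adjPairs τ))

Acount : ∀ {n} → Permutation′ n → List (Fin n) → ℕ
Acount σ τ = length (filter (λ p → (Data.Product.proj₁ p <? Data.Product.proj₂ p)
                                   ×-dec ((σ ⟨$⟩ʳ Data.Product.proj₁ p) ≟ Data.Product.proj₂ p))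
                            (adjPairs τ))

-- Write τ = Φ(σ) as the concatenation of the cycles (m, σ m, …, σ^q m), each starting at its
-- maximum m.  Inside a cycle every adjacent pair is (a, σ a) with a ≠ σ a, so it is either a
-- descent or an ascent with σ a = next letter: a cycle of length q + 1 contributes exactly q.
-- At the junction of the cycle of m with the next maximum m' > m, the last letter c of the cycle
-- satisfies c ≤ m < m' and σ c = m ≠ m': an ascent not counted by A.  Hence
-- [21](τ) + A(τ) = n − (number of cycles) = ℓ_T(σ).
module Submission where

open import Defs
open import Data.Empty using (⊥-elim)
open import Data.Fin as F using (Fin; toℕ)
import Data.Fin.Properties as FP
open import Data.Fin.Permutation using (Permutation′; _⟨$⟩ʳ_; _⟨$⟩ˡ_; inverseˡ)
open import Data.List using (List; []; _∷_; _++_; [_]; map; filter; takeWhile; concatMap; length; lookup; allFin; upTo; applyUpTo)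
import Data.List.Extrema
import Data.List.Properties as LP
open import Data.List.Membership.Propositional using (_∈_; lose)
open import Data.List.Membership.Propositional.Properties
  using (∈-filter⁺; ∈-allFin; ∈-concatMap⁺; ∈-lookup)
import Data.List.Membership.Setoid.Properties as SetoidMembership
open import Data.List.Relation.Binary.Disjoint.Propositional using (Disjoint)
open import Data.List.Relation.Unary.All as All using (All; []; _∷_)
open import Data.List.Relation.Unary.AllPairs using (AllPairs; []; _∷_)
import Data.List.Relation.Unary.AllPairs.Properties as AllPairsProp
import Data.List.Relation.Unary.All.Properties as AllProp
open import Data.List.Relation.Unary.Any using (here; there)
open import Data.List.Relation.Unary.Unique.Propositional using (Unique)
import Data.List.Relation.Unary.Unique.Propositional.Properties as UniqueProp
open import Data.Nat as ℕ using (ℕ; zero; suc; _+_; _*_; _∸_; z<s; s<s)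
import Data.Nat.Properties as NP
open import Data.Nat.Solver using (module +-*-Solver)
open import Algebra.Properties.CommutativeSemigroup NP.+-commutativeSemigroup using (interchange)
open import Data.Product using (∃-syntax; _×_; _,_; proj₁; proj₂)
open import Data.Sum using (inj₁; inj₂)
open import Function using (_∘_)
open import Level using (0ℓ)
open import Relation.Nullary using (¬_; yes; no)
open import Relation.Nullary.Decidable using (¬?; _×-dec_)
open import Relation.Unary using (Pred; Decidable)
open import Relation.Binary.Definitions using (tri<; tri≈; tri>)
open import Relation.Binary.PropositionalEquality
  using (_≡_; _≢_; refl; sym; trans; cong; cong₂; subst; subst₂; setoid; module ≡-Reasoning)

module _ {A : Set} where

  final : A → List A → A
  final x []       = x
  final _ (y ∷ ys) = final y ys

  final∈ : ∀ x xs → final x xs ∈ x ∷ xs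
  final∈ x []       = here refl
  final∈ x (y ∷ ys) = there (final∈ y ys)

  adjPairs-++ : ∀ x xs y ys →
                adjPairs (x ∷ xs ++ y ∷ ys) ≡ adjPairs (x ∷ xs) ++ (final x xs , y) ∷ adjPairs (y ∷ ys)
  adjPairs-++ x []       y ys = refl
  adjPairs-++ x (z ∷ zs) y ys = cong ((x , z) ∷_) (adjPairs-++ z zs y ys)

  Unique⇒lookup-injective : ∀ {xs : List A} → Unique xs → ∀ {i j} → lookup xs i ≡ lookup xs j → i ≡ j
  Unique⇒lookup-injective {_ ∷ _}  (_ ∷ _)     {F.zero}  {F.zero}  _ = refl
  Unique⇒lookup-injective {_ ∷ _}  (x∉ ∷ _)    {F.zero}  {F.suc j} e = ⊥-elim (All.lookup x∉ (∈-lookup j) e)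
  Unique⇒lookup-injective {_ ∷ _}  (x∉ ∷ _)    {F.suc i} {F.zero}  e = ⊥-elim (All.lookup x∉ (∈-lookup i) (sym e))
  Unique⇒lookup-injective {_ ∷ _}  (_ ∷ uniq)  {F.suc i} {F.suc j} e = cong F.suc (Unique⇒lookup-injective uniq e)

module _ {A : Set} {P : Pred A 0ℓ} (P? : Decidable P) where

  count : List A → ℕ
  count xs = length (filter P? xs)

  count-++ : ∀ xs ys → count (xs ++ ys) ≡ count xs + count ys
  count-++ xs ys = trans (cong length (LP.filter-++ P? xs ys)) (LP.length-++ (filter P? xs))

  count-[x]≡1 : ∀ {x} → P x → count [ x ] ≡ 1
  count-[x]≡1 Px = cong length (LP.filter-accept P? Px)

  count-[x]≡0 : ∀ {x} → ¬ P x → count [ x ] ≡ 0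
  count-[x]≡0 ¬Px = cong length (LP.filter-reject P? ¬Px)

  filter⁺-guarded : ∀ {R : A → A → Set} {xs} →
                    AllPairs (λ x y → P x → P y → R x y) xs → AllPairs R (filter P? xs)
  filter⁺-guarded {xs = []}     [] = []
  filter⁺-guarded {xs = x ∷ xs} (Rx ∷ Rxs) with P? x
  ... | yes Px = All.zipWith (λ (R? , Py) → R? Px Py) (AllProp.filter⁺ P? Rx , AllProp.all-filter P? xs)
                 ∷ filter⁺-guarded Rxs
  ... | no  _  = filter⁺-guarded Rxs

length-enumeration : ∀ {n} {xs : List (Fin n)} → Unique xs → (∀ x → x ∈ xs) → length xs ≡ n
length-enumeration {n} uniq complete =
  FP.cantor-schröder-bernstein (Unique⇒lookup-injective uniq)
    (SetoidMembership.index-injective (setoid (Fin n)) (complete _) (complete _))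

module _ {n} (σ : Permutation′ n) where

  iter-+ : ∀ a b x → iter σ (a + b) x ≡ iter σ a (iter σ b x)
  iter-+ zero    b x = refl
  iter-+ (suc a) b x = cong (σ ⟨$⟩ʳ_) (iter-+ a b x)

  iter-sucʳ : ∀ k x → iter σ k (σ ⟨$⟩ʳ x) ≡ iter σ (suc k) x
  iter-sucʳ k x = trans (sym (iter-+ k 1 x)) (cong (λ i → iter σ i x) (NP.+-comm k 1))

  σ-injective : ∀ {x y} → σ ⟨$⟩ʳ x ≡ σ ⟨$⟩ʳ y → x ≡ y
  σ-injective {x} {y} e = trans (sym (inverseˡ σ)) (trans (cong (σ ⟨$⟩ˡ_) e) (inverseˡ σ))

  iter-injective : ∀ k {x y} → iter σ k x ≡ iter σ k y → x ≡ y
  iter-injective zero    e = e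
  iter-injective (suc k) e = iter-injective k (σ-injective e)

  -- Two of the n + 1 points x, σ x, …, σⁿ x coincide; injectivity cancels the common prefix.
  period : ∀ x → ∃[ p ] 0 ℕ.< p × p ℕ.≤ n × iter σ p x ≡ x
  period x with FP.pigeonhole (NP.n<1+n n) (λ (i : Fin (suc n)) → iter σ (toℕ i) x)
  ... | i , j , i<j , σⁱx≡σʲx =
    toℕ j ∸ toℕ i , NP.m<n⇒0<n∸m i<j , p≤n , sym (iter-injective (toℕ i) σⁱx≡σⁱσᵖx)
    where
    p≤n : toℕ j ∸ toℕ i ℕ.≤ n
    p≤n = NP.≤-trans (NP.m∸n≤m (toℕ j) (toℕ i)) (NP.≤-pred (FP.toℕ<n j))
    σⁱx≡σⁱσᵖx : iter σ (toℕ i) x ≡ iter σ (toℕ i) (iter σ (toℕ j ∸ toℕ i) x)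
    σⁱx≡σⁱσᵖx = begin
      iter σ (toℕ i) x                               ≡⟨ σⁱx≡σʲx ⟩
      iter σ (toℕ j) x                               ≡⟨ cong (λ k → iter σ k x) (sym (NP.m+[n∸m]≡n (NP.<⇒≤ i<j))) ⟩
      iter σ (toℕ i + (toℕ j ∸ toℕ i)) x              ≡⟨ iter-+ (toℕ i) _ x ⟩
      iter σ (toℕ i) (iter σ (toℕ j ∸ toℕ i) x)      ∎
      where open ≡-Reasoning

  iter-mod : ∀ {p x} → 0 ℕ.< p → iter σ p x ≡ x → ∀ k → ∃[ j ] j ℕ.< p × iter σ k x ≡ iter σ j x
  iter-mod 0<p σᵖx≡x zero = 0 , 0<p , refl
  iter-mod 0<p σᵖx≡x (suc k) with iter-mod 0<p σᵖx≡x k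
  ... | j , j<p , e with NP.m≤n⇒m<n∨m≡n j<p
  ...   | inj₁ 1+j<p = suc j , 1+j<p , cong (σ ⟨$⟩ʳ_) e
  ...   | inj₂ refl  = 0 , 0<p , trans (cong (σ ⟨$⟩ʳ_) e) σᵖx≡x

  iter-*-period : ∀ {p x} → iter σ p x ≡ x → ∀ k → iter σ (k * p) x ≡ x
  iter-*-period         σᵖx≡x zero    = refl
  iter-*-period {p} {x} σᵖx≡x (suc k) =
    trans (iter-+ p (k * p) x) (trans (cong (iter σ p) (iter-*-period σᵖx≡x k)) σᵖx≡x)

  iter-return : ∀ i x → ∃[ c ] iter σ c (iter σ i x) ≡ x
  iter-return i x with period x
  ... | suc p , _ , _ , σᵖx≡x = i * p , (begin
      iter σ (i * p) (iter σ i x)   ≡⟨ sym (iter-+ (i * p) i x) ⟩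
      iter σ (i * p + i) x          ≡⟨ cong (λ k → iter σ k x) (trans (NP.+-comm (i * p) i) (sym (NP.*-suc i p))) ⟩
      iter σ (i * suc p) x          ≡⟨ iter-*-period σᵖx≡x i ⟩
      x                             ∎)
    where open ≡-Reasoning

  walk : Fin n → ℕ → List (Fin n)
  walk x zero    = []
  walk x (suc k) = x ∷ walk (σ ⟨$⟩ʳ x) k

  length-walk : ∀ k x → length (walk x k) ≡ k
  length-walk zero    x = refl
  length-walk (suc k) x = cong suc (length-walk k (σ ⟨$⟩ʳ x))

  iter-∈-walk : ∀ {j} k x → j ℕ.< k → iter σ j x ∈ walk x k
  iter-∈-walk {zero}  (suc k) x _         = here refl
  iter-∈-walk {suc j} (suc k) x (s<s j<k) =
    there (subst (_∈ walk (σ ⟨$⟩ʳ x) k) (iter-sucʳ j x) (iter-∈-walk k (σ ⟨$⟩ʳ x) j<k))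

  ∈-walk⁻ : ∀ {y} k x → y ∈ walk x k → ∃[ j ] j ℕ.< k × y ≡ iter σ j x
  ∈-walk⁻ (suc k) x (here y≡x) = 0 , z<s , y≡x
  ∈-walk⁻ (suc k) x (there y∈) with ∈-walk⁻ k (σ ⟨$⟩ʳ x) y∈
  ... | j , j<k , y≡σʲσx = suc j , s<s j<k , trans y≡σʲσx (iter-sucʳ j x)

  applyUpTo-walk : ∀ {f : ℕ → Fin n} x → (∀ j → f j ≡ iter σ j x) → ∀ k → applyUpTo f k ≡ walk x k
  applyUpTo-walk x f≡ zero    = refl
  applyUpTo-walk x f≡ (suc k) =
    cong₂ _∷_ (f≡ 0) (applyUpTo-walk (σ ⟨$⟩ʳ x) (λ j → trans (f≡ (suc j)) (sym (iter-sucʳ j x))) k)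

  orbit≡walk : ∀ x → orbit σ x ≡ walk x n
  orbit≡walk x = trans (LP.map-upTo (λ k → iter σ k x) n) (applyUpTo-walk x (λ _ → refl) n)

  walk-unique : ∀ k x → (∀ j → suc j ℕ.< k → iter σ (suc j) x ≢ x) → Unique (walk x k)
  walk-unique zero    x _         = []
  walk-unique (suc k) x no-return = All.tabulate x∉ ∷ walk-unique k (σ ⟨$⟩ʳ x) no-return′
    where
    x∉ : ∀ {y} → y ∈ walk (σ ⟨$⟩ʳ x) k → x ≢ y
    x∉ y∈ x≡y with ∈-walk⁻ k (σ ⟨$⟩ʳ x) y∈
    ... | j , j<k , y≡σʲσx = no-return j (s<s j<k) (sym (trans x≡y (trans y≡σʲσx (iter-sucʳ j x))))
    no-return′ : ∀ j → suc j ℕ.< k → iter σ (suc j) (σ ⟨$⟩ʳ x) ≢ σ ⟨$⟩ʳ x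
    no-return′ j 1+j<k e =
      no-return j (NP.m<n⇒m<1+n 1+j<k) (σ-injective (trans (cong (σ ⟨$⟩ʳ_) (sym (iter-sucʳ j x))) e))

  takeWhile-walk : ∀ {m j} k x → j ℕ.< k → iter σ j x ≡ m →
                   ∃[ q ] takeWhile (λ y → ¬? (y F.≟ m)) (walk x k) ≡ walk x q
                        × iter σ q x ≡ m × (∀ i → i ℕ.< q → iter σ i x ≢ m)
  takeWhile-walk {m} (suc k) x _ _ with x F.≟ m
  ... | yes x≡m = 0 , refl , x≡m , λ _ ()
  takeWhile-walk {m} {zero}  (suc k) x _ x≡m | no x≢m = ⊥-elim (x≢m x≡m)
  takeWhile-walk {m} {suc j} (suc k) x (s<s j<k) σʲ⁺¹x≡m | no x≢m
    with takeWhile-walk k (σ ⟨$⟩ʳ x) j<k (trans (iter-sucʳ j x) σʲ⁺¹x≡m)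
  ... | q , tw , σ^qσx≡m , before = suc q , cong (x ∷_) tw , trans (sym (iter-sucʳ q x)) σ^qσx≡m , before′
    where
    before′ : ∀ i → i ℕ.< suc q → iter σ i x ≢ m
    before′ zero    _         = x≢m
    before′ (suc i) (s<s i<q) = before i i<q ∘ trans (iter-sucʳ i x)

  record CycleWalk (m : Fin n) : Set where
    field
      q               : ℕ
      cycleFrom≡walk  : cycleFrom σ m ≡ walk m (suc q)
      returns         : iter σ (suc q) m ≡ m
      no-early-return : ∀ j → j ℕ.< q → iter σ (suc j) m ≢ m

  cycleWalk : ∀ m → CycleWalk m
  cycleWalk m with period m
  ... | suc p , _ , p<n , σᵖ⁺¹m≡m
    with takeWhile-walk n (σ ⟨$⟩ʳ m) p<n (trans (iter-sucʳ p m) σᵖ⁺¹m≡m)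
  ... | q , tw , σ^qσm≡m , before = record
    { q               = q
    ; cycleFrom≡walk  = cong (m ∷_) (trans (cong (takeWhile _) σ-tail≡walk) tw)
    ; returns         = trans (sym (iter-sucʳ q m)) σ^qσm≡m
    ; no-early-return = λ j j<q → before j j<q ∘ trans (iter-sucʳ j m)
    }
    where
    σ-tail≡walk : map (λ k → iter σ (suc k) m) (upTo n) ≡ walk (σ ⟨$⟩ʳ m) n
    σ-tail≡walk = trans (LP.map-upTo _ n) (applyUpTo-walk (σ ⟨$⟩ʳ m) (λ j → sym (iter-sucʳ j m)) n)

  iter-∈-cycleFrom : ∀ m k → iter σ k m ∈ cycleFrom σ m
  iter-∈-cycleFrom m k =
    let j , j<1+q , σᵏm≡σʲm = iter-mod z<s returns k
    in subst₂ _∈_ (sym σᵏm≡σʲm) (sym cycleFrom≡walk) (iter-∈-walk (suc q) m j<1+q)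
    where open CycleWalk (cycleWalk m)

  ∈-cycleFrom⁻ : ∀ {m x} → x ∈ cycleFrom σ m → ∃[ j ] x ≡ iter σ j m
  ∈-cycleFrom⁻ {m} {x} x∈ =
    let j , _ , x≡σʲm = ∈-walk⁻ (suc q) m (subst (x ∈_) cycleFrom≡walk x∈)
    in j , x≡σʲm
    where open CycleWalk (cycleWalk m)

  cycleFrom-unique : ∀ m → Unique (cycleFrom σ m)
  cycleFrom-unique m =
    subst Unique (sym cycleFrom≡walk) (walk-unique (suc q) m (λ j 1+j<1+q → no-early-return j (NP.≤-pred 1+j<1+q)))
    where open CycleWalk (cycleWalk m)

  All-orbit⁻ : ∀ {P : Pred (Fin n) 0ℓ} {x} → All P (orbit σ x) → ∀ k → P (iter σ k x)
  All-orbit⁻ {P} {x} all k with period x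
  ... | p , 0<p , p≤n , σᵖx≡x with iter-mod 0<p σᵖx≡x k
  ...   | j , j<p , σᵏx≡σʲx =
    subst P (sym σᵏx≡σʲx)
          (All.lookup all (subst (iter σ j x ∈_) (sym (orbit≡walk x)) (iter-∈-walk n x (NP.<-≤-trans j<p p≤n))))

  All-orbit⁺ : ∀ {P : Pred (Fin n) 0ℓ} {x} → (∀ k → P (iter σ k x)) → All P (orbit σ x)
  All-orbit⁺ {P} {x} Pσᵏx = subst (All P) (sym (orbit≡walk x)) (All.tabulate P∈)
    where
    P∈ : ∀ {y} → y ∈ walk x n → P y
    P∈ y∈ with ∈-walk⁻ n x y∈
    ... | j , _ , refl = Pσᵏx j

  iter-≤-cycleMax : ∀ {m} → IsCycleMax σ m → ∀ k → iter σ k m F.≤ m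
  iter-≤-cycleMax = All-orbit⁻

  -- The witness is the maximum of the orbit of x.
  ∈-cycleFrom-cycleMax : ∀ x → ∃[ m ] IsCycleMax σ m × x ∈ cycleFrom σ m
  ∈-cycleFrom-cycleMax x = m , All-orbit⁺ σᵏm≤m , subst (_∈ cycleFrom σ m) σᶜm≡x (iter-∈-cycleFrom m c)
    where
    open Data.List.Extrema (FP.≤-totalOrder n) using (max; argmax-sel; xs≤max)
    m = max x (orbit σ x)
    m-iterate : ∃[ a ] m ≡ iter σ a x
    m-iterate with argmax-sel (λ y → y) x (orbit σ x)
    ... | inj₁ m≡x = 0 , m≡x
    ... | inj₂ m∈  with ∈-walk⁻ n x (subst (m ∈_) (orbit≡walk x) m∈)
    ...   | a , _ , m≡σᵃx = a , m≡σᵃx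
    a = proj₁ m-iterate
    σᵏm≤m : ∀ k → iter σ k m F.≤ m
    σᵏm≤m k = subst (F._≤ m) (trans (iter-+ k a x) (cong (iter σ k) (sym (proj₂ m-iterate))))
                    (All-orbit⁻ (xs≤max x (orbit σ x)) (k + a))
    c = proj₁ (iter-return a x)
    σᶜm≡x : iter σ c m ≡ x
    σᶜm≡x = trans (cong (iter σ c) (proj₂ m-iterate)) (proj₂ (iter-return a x))

  cycleMax-≤ : ∀ {m m′ x} → IsCycleMax σ m′ → x ∈ cycleFrom σ m → x ∈ cycleFrom σ m′ → m F.≤ m′
  cycleMax-≤ {m} {m′} max′ x∈ x∈′ with ∈-cycleFrom⁻ x∈ | ∈-cycleFrom⁻ x∈′
  ... | i , x≡σⁱm | j , x≡σʲm′ with iter-return i m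
  ...   | c , σᶜσⁱm≡m = subst (F._≤ m′) σᶜ⁺ʲm′≡m (iter-≤-cycleMax max′ (c + j))
    where
    σᶜ⁺ʲm′≡m : iter σ (c + j) m′ ≡ m
    σᶜ⁺ʲm′≡m = trans (iter-+ c j m′) (trans (cong (iter σ c) (trans (sym x≡σʲm′) x≡σⁱm)) σᶜσⁱm≡m)

  cycleFrom-disjoint : ∀ {m m′} → m ≢ m′ → IsCycleMax σ m → IsCycleMax σ m′ →
                       Disjoint (cycleFrom σ m) (cycleFrom σ m′)
  cycleFrom-disjoint m≢m′ max max′ (x∈ , x∈′) =
    m≢m′ (FP.≤-antisym (cycleMax-≤ max′ x∈ x∈′) (cycleMax-≤ max x∈′ x∈))

  ∈-Φ : ∀ x → x ∈ Φ σ
  ∈-Φ x with ∈-cycleFrom-cycleMax x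
  ... | m , max , x∈ = ∈-concatMap⁺ (cycleFrom σ) (lose (∈-filter⁺ (isCycleMax? σ) (∈-allFin m) max) x∈)

  Φ-unique : Unique (Φ σ)
  Φ-unique = UniqueProp.concat⁺
    (AllProp.map⁺ (All.universal cycleFrom-unique (cycleMaxima σ)))
    (AllPairsProp.map⁺ (filter⁺-guarded (isCycleMax? σ) (AllPairsProp.tabulate⁺ cycleFrom-disjoint)))

  length-Φ : length (Φ σ) ≡ n
  length-Φ = length-enumeration Φ-unique ∈-Φ

  descent? : Decidable {A = Fin n × Fin n} (λ p → proj₂ p F.< proj₁ p)
  descent? p = proj₂ p F.<? proj₁ p

  σ-ascent? : Decidable {A = Fin n × Fin n} (λ p → proj₁ p F.< proj₂ p × σ ⟨$⟩ʳ proj₁ p ≡ proj₂ p)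
  σ-ascent? p = (proj₁ p F.<? proj₂ p) ×-dec (σ ⟨$⟩ʳ proj₁ p F.≟ proj₂ p)

  statistic : List (Fin n × Fin n) → ℕ
  statistic ps = count descent? ps + count σ-ascent? ps

  statistic-++ : ∀ ps qs → statistic (ps ++ qs) ≡ statistic ps + statistic qs
  statistic-++ ps qs = trans (cong₂ _+_ (count-++ descent? ps qs) (count-++ σ-ascent? ps qs))
                             (interchange (count descent? ps) _ _ _)

  statistic-step : ∀ x → x ≢ σ ⟨$⟩ʳ x → statistic [ (x , σ ⟨$⟩ʳ x) ] ≡ 1
  statistic-step x x≢σx with FP.<-cmp x (σ ⟨$⟩ʳ x)
  ... | tri< x<σx _ _ = cong₂ _+_ (count-[x]≡0 descent? (NP.<-asym x<σx)) (count-[x]≡1 σ-ascent? (x<σx , refl))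
  ... | tri≈ _ x≡σx _ = ⊥-elim (x≢σx x≡σx)
  ... | tri> _ _ σx<x = cong₂ _+_ (count-[x]≡1 descent? σx<x) (count-[x]≡0 σ-ascent? (NP.<-asym σx<x ∘ proj₁))

  statistic-junction : ∀ {a b} → a F.< b → σ ⟨$⟩ʳ a F.< b → statistic [ (a , b) ] ≡ 0
  statistic-junction a<b σa<b = cong₂ _+_ (count-[x]≡0 descent? (NP.<-asym a<b))
                                          (count-[x]≡0 σ-ascent? (λ (_ , σa≡b) → NP.<-irrefl (cong toℕ σa≡b) σa<b))

  statistic-walk : ∀ k x → σ ⟨$⟩ʳ x ≢ x → statistic (adjPairs (walk x (suc k))) ≡ k
  statistic-walk zero    x _       = refl
  statistic-walk (suc k) x σx≢x =
    trans (statistic-++ [ (x , σ ⟨$⟩ʳ x) ] (adjPairs (walk (σ ⟨$⟩ʳ x) (suc k))))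
          (cong₂ _+_ (statistic-step x (σx≢x ∘ sym)) (statistic-walk k (σ ⟨$⟩ʳ x) (σx≢x ∘ σ-injective)))

  statistic-cycle : ∀ m → statistic (adjPairs (cycleFrom σ m)) + 1 ≡ length (cycleFrom σ m)
  statistic-cycle m =
    subst (λ c → statistic (adjPairs c) + 1 ≡ length c) (sym cycleFrom≡walk) (walk-count q no-early-return)
    where
    open CycleWalk (cycleWalk m)
    walk-count : ∀ q → (∀ j → j ℕ.< q → iter σ (suc j) m ≢ m) →
                 statistic (adjPairs (walk m (suc q))) + 1 ≡ length (walk m (suc q))
    walk-count zero     _               = refl
    walk-count (suc q′) no-early-return = begin
      statistic (adjPairs (walk m (suc (suc q′)))) + 1   ≡⟨ cong (_+ 1) (statistic-walk (suc q′) m (no-early-return 0 z<s)) ⟩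
      suc q′ + 1                                         ≡⟨ NP.+-comm (suc q′) 1 ⟩
      suc (suc q′)                                       ≡⟨ sym (length-walk (suc (suc q′)) m) ⟩
      length (walk m (suc (suc q′)))                     ∎
      where open ≡-Reasoning

  statistic-junction-cycleFrom : ∀ {m m′ c} → IsCycleMax σ m → m F.< m′ → c ∈ cycleFrom σ m →
                                 statistic [ (c , m′) ] ≡ 0
  statistic-junction-cycleFrom max m<m′ c∈ with ∈-cycleFrom⁻ c∈
  ... | j , refl = statistic-junction (NP.≤-<-trans (iter-≤-cycleMax max j) m<m′)
                                      (NP.≤-<-trans (iter-≤-cycleMax max (suc j)) m<m′)

  statistic-cycles : ∀ ms → AllPairs F._<_ ms → All (IsCycleMax σ) ms →
                     statistic (adjPairs (concatMap (cycleFrom σ) ms)) + length ms ≡ length (concatMap (cycleFrom σ) ms)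
  statistic-cycles []            _ _ = refl
  statistic-cycles (m ∷ [])      _ _ =
    subst (λ c → statistic (adjPairs c) + 1 ≡ length c) (sym (LP.++-identityʳ (cycleFrom σ m))) (statistic-cycle m)
  statistic-cycles (m ∷ m′ ∷ ms) ((m<m′ ∷ _) ∷ sorted) (max ∷ maxs) = begin
    statistic (adjPairs (m ∷ xs ++ m′ ∷ ys)) + suc r
      ≡⟨ cong (λ ps → statistic ps + suc r) (adjPairs-++ m xs m′ ys) ⟩
    statistic (adjPairs (m ∷ xs) ++ [ (final m xs , m′) ] ++ adjPairs (m′ ∷ ys)) + suc r
      ≡⟨ cong (_+ suc r) (trans (statistic-++ (adjPairs (m ∷ xs)) _) (cong (A +_) (statistic-++ [ (final m xs , m′) ] _))) ⟩
    A + (statistic [ (final m xs , m′) ] + B) + suc r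
      ≡⟨ cong (λ j → A + (j + B) + suc r) (statistic-junction-cycleFrom max m<m′ (final∈ m xs)) ⟩
    A + B + suc r
      ≡⟨ solve 3 (λ a b r → (a :+ b) :+ (con 1 :+ r) := (a :+ con 1) :+ (b :+ r)) refl A B r ⟩
    (A + 1) + (B + r)
      ≡⟨ cong₂ _+_ (statistic-cycle m) (statistic-cycles (m′ ∷ ms) sorted maxs) ⟩
    length (m ∷ xs) + length (m′ ∷ ys)
      ≡⟨ sym (LP.length-++ (m ∷ xs)) ⟩
    length (m ∷ xs ++ m′ ∷ ys)
      ∎
    where
    open ≡-Reasoning
    open +-*-Solver
    -- cycleFrom σ k is definitionally k ∷ tail k.
    tail : Fin n → List (Fin n)
    tail k = takeWhile (λ y → ¬? (y F.≟ k)) (map (λ i → iter σ (suc i) k) (upTo n))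
    xs = tail m
    ys = tail m′ ++ concatMap (cycleFrom σ) ms
    A = statistic (adjPairs (m ∷ xs))
    B = statistic (adjPairs (m′ ∷ ys))
    r = length (m′ ∷ ms)

  statistic-Φ : statistic (adjPairs (Φ σ)) + numCycles σ ≡ n
  statistic-Φ =
    trans (statistic-cycles (cycleMaxima σ) cycleMaxima-sorted (AllProp.all-filter (isCycleMax? σ) (allFin n)))
          length-Φ
    where
    cycleMaxima-sorted : AllPairs F._<_ (cycleMaxima σ)
    cycleMaxima-sorted = AllPairsProp.filter⁺ (isCycleMax? σ) (AllPairsProp.tabulate⁺-< (λ i<j → i<j))

proposition4p3 : (n : ℕ) (σ : Permutation′ n) → ℓT σ ≡ des (Φ σ) + Acount σ (Φ σ)
proposition4p3 n σ = begin
  ℓT σ                                                     ≡⟨⟩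
  n ∸ numCycles σ                                          ≡⟨ cong (_∸ numCycles σ) (sym (statistic-Φ σ)) ⟩
  statistic σ (adjPairs (Φ σ)) + numCycles σ ∸ numCycles σ ≡⟨ NP.m+n∸n≡m _ (numCycles σ) ⟩
  statistic σ (adjPairs (Φ σ))                             ≡⟨⟩
  des (Φ σ) + Acount σ (Φ σ)                               ∎
  where open ≡-Reasoning
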